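{- Let $j\ge 1$ and let $a,b$ be integers with $g=\gcd(a,b)>1$; write $a=a_1g$, $b=b_1g$. Then there is a finite set $R$ of positive integers such that $$R^{(j)}_{a,b}=\{\,n=Gn_1:\ G\in\mathcal F_g,\ n_1\in R^{(j)}_{a_1^G,\,b_1^G},\ \gcd(g,n_1)=1\,\}\setminus R .$$ Moreover, every element $n=Gn_1$ of $R$ (with $G\in\mathcal F_g$ and $\gcd(n_1,g)=1$) satisfies $1\le n_1<j/2$ and $G=q_1^{\ell_1}\cdots q_m^{\ell_m}$ with $\sum_{i=1}^m \ell_i<K^{(j)}_{g^{n_1}}$, where $q_1,\dots,q_m$ are the distinct primes dividing $g$ and $\ell_i\ge 0$.
   Context: For integers $a,b$ and $j\ge 1$, $R^{(j)}_{a,b}=\{n\in\mathbb N: n^j\mid a^n-b^n\}$. For an integer $c>1$, $\mathcal F_c$ is the set of all positive integers all of whose prime factors divide $c$ (so $1\in\mathcal F_c$). For an integer $c>1$ with prime factorization $c=p_1^{c_1}\cdots p_r^{c_r}$ where $p_1$ is the smallest prime factor of $c$, $K^{(j)}_c$ denotes the smallest positive integer $K$ such that $K p_1^{ -K}\le (\min_{1\le i\le r} c_i)/j$. -}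

module Defs where

open import Data.Nat as ℕ using (ℕ; _+_; _*_; _^_; _≤_; _<_)
open import Data.Nat.Divisibility as ℕD using ()
open import Data.Nat.Primality using (Prime)
open import Data.Integer as ℤ using (ℤ; +_; _-_)
open import Data.Integer.Divisibility as ℤD using ()
open import Data.Product using (_×_; Σ; ∃; ∃-syntax)
open import Relation.Nullary using (¬_)

InR : ℕ → ℤ → ℤ → ℕ → Set
InR j a b n = (1 ≤ n) × ((+ n) ℤ.^ j) ℤD.∣ ((a ℤ.^ n) - (b ℤ.^ n))

InF : ℕ → ℕ → Set
InF c G = (1 ≤ G) × (∀ p → Prime p → p ℕD.∣ G → p ℕD.∣ c)

IsSmallestPrimeFactor : ℕ → ℕ → Set
IsSmallestPrimeFactor c p =
  Prime p × p ℕD.∣ c × (∀ q → Prime q → q ℕD.∣ c → p ≤ q)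

-- m = min_i c_i where c = p_1^{c_1} ⋯ p_r^{c_r}: m is the exponent of some prime
-- factor of c (exact power), and every prime factor of c occurs to power ≥ m.
IsMinExponent : ℕ → ℕ → Set
IsMinExponent c m =
  (∃[ p ] (Prime p × p ^ m ℕD.∣ c × ¬ (p ^ (m + 1) ℕD.∣ c)))
  × (∀ q → Prime q → q ℕD.∣ c → q ^ m ℕD.∣ c)

-- The defining inequality K p₁^{-K} ≤ m / j, with denominators cleared
-- (all quantities positive):  K * j ≤ m * p₁^K.
KCond : ℕ → ℕ → ℕ → Set
KCond j c K = ∃[ p ] ∃[ m ]
  (IsSmallestPrimeFactor c p × IsMinExponent c m × K * j ≤ m * p ^ K)

IsK : ℕ → ℕ → ℕ → Set
IsK j c K = (1 ≤ K) × KCond j c K × (∀ K′ → 1 ≤ K′ → K′ < K → ¬ KCond j c K′)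

module Submission where

-- Write n = G n₁ with G ∈ 𝓕_g and gcd(g, n₁) = 1 (such a decomposition exists
-- and is unique).  Since a = a₁ g and b = b₁ g we have
-- |aⁿ - bⁿ| = |a₁ⁿ - b₁ⁿ| gⁿ, and as n₁ is coprime to g while G is coprime to
-- n₁, the condition nʲ ∣ aⁿ - bⁿ splits into n₁ʲ ∣ a₁^{G n₁} - b₁^{G n₁}
-- (i.e. n₁ ∈ R^{(j)}_{a₁^G, b₁^G}) and Gʲ ∣ |a₁ⁿ - b₁ⁿ| gⁿ.  The second
-- condition can only fail when Gʲ ∤ gⁿ, and that forces n to be small:
-- G ∣ g^k with 2^k ≤ G gives n < j k and k < j + 4, hence n ≤ j (j + 4),
-- and also 2 n₁ < j; the defining inequality of K^{(j)}_{g^{n₁}} bounds the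
-- total exponent of G.  The exceptional set R is therefore the finite list
-- of candidates n ≤ j (j + 4) that do not lie in R^{(j)}_{a,b}.
--
-- Module Setting
-- transfers everything to R^{(j)}_{a,b} and builds R.

open import Defs
open import Data.Nat as ℕ using (ℕ; _+_; _*_; _^_; _≤_; _<_)
open import Data.Nat.Divisibility as ℕD using ()
open import Data.Nat.Primality using (Prime)
open import Data.Integer as ℤ using (ℤ; +_)
open import Data.Integer.GCD as ℤG using ()
open import Data.Nat.GCD as ℕG using ()
open import Data.List using (List; length; zipWith)
open import Data.Nat.ListAction using (product; sum)
open import Data.List.Relation.Unary.All using (All)
open import Data.List.Relation.Unary.Unique.Propositional using (Unique)
open import Data.List.Membership.Propositional using (_∈_; _∉_)
open import Data.Product using (_×_; Σ; ∃; ∃-syntax)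
open import Function.Bundles using (_⇔_)
open import Relation.Binary.PropositionalEquality using (_≡_)

open import Data.Nat using (zero; suc; _∸_; z≤n; s≤s; z<s; NonZero; _≤?_; _<?_)
open import Data.Nat.Base using (nonTrivial⇒n>1; >-nonZero)
open import Data.Nat.Properties
open import Data.Nat.Divisibility
open import Data.Nat.Coprimality as Coprime using (Coprime; coprime-divisor; gcd≡1⇒coprime)
open import Data.Nat.Primality using (prime⇒nonTrivial; prime⇒irreducible; euclidsLemma)
open import Data.Nat.Primality.Factorisation using (factorise)
open import Data.Nat.GCD using (gcd; gcd-comm; gcd[m,n]∣m; gcd[m,n]∣n; gcd[m,n]≡0⇒m≡0)
open import Data.Nat.Induction using (<-wellFounded)
open import Data.Nat.Tactic.RingSolver using (solve-∀)
open import Data.List using ([]; _∷_; replicate; upTo; filter)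
open import Data.List.Properties using (length-replicate)
open import Data.List.Relation.Unary.All as All using ([]; _∷_)
open import Data.List.Relation.Unary.AllPairs using ([]; _∷_)
open import Data.List.Relation.Unary.Any using (here; there)
open import Data.List.Membership.Propositional.Properties using (∈-filter⁺; ∈-filter⁻; ∈-upTo⁺)
open import Data.Product using (_,_; proj₁; proj₂)
open import Data.Sum using (inj₁; inj₂)
open import Data.Empty using (⊥-elim)
open import Induction.WellFounded using (Acc; acc)
open import Relation.Nullary using (¬_; Dec; yes; no)
open import Relation.Nullary.Decidable using (_×-dec_; ¬?)
open import Relation.Binary.PropositionalEquality using (_≢_; refl; sym; trans; cong; cong₂; subst; subst₂; module ≡-Reasoning)
open import Function.Bundles using (mk⇔; Equivalence)
open import Function.Base using (case_of_)
import Data.Integer.Properties as ℤP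
import Data.Integer.Tactic.RingSolver as ZR

prime≥2 : ∀ {p} → Prime p → 2 ≤ p
prime≥2 {p} pp = nonTrivial⇒n>1 p {{prime⇒nonTrivial pp}}

prime∤1 : ∀ {p} → Prime p → ¬ (p ∣ 1)
prime∤1 pp p∣1 = <⇒≢ (prime≥2 pp) (sym (∣1⇒≡1 p∣1))

prime-divisor : ∀ n → 1 < n → ∃[ p ] (Prime p × p ∣ n)
prime-divisor n 1<n with factorise n {{>-nonZero (<-trans z<s 1<n)}}
... | record { factors = [] ; isFactorisation = n≡1 } = ⊥-elim (<⇒≢ 1<n (sym n≡1))
... | record { factors = p ∷ ps ; isFactorisation = n≡p*ps ; factorsPrime = pp ∷ _ } =
  p , pp , subst (p ∣_) (sym n≡p*ps) (m∣m*n (product ps))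

coprime-∣ʳ : ∀ {m n d} → Coprime m n → d ∣ n → Coprime m d
coprime-∣ʳ c d∣n (i∣m , i∣d) = c (i∣m , ∣-trans i∣d d∣n)

coprime-*ʳ : ∀ {m n o} → Coprime m n → Coprime m o → Coprime m (n * o)
coprime-*ʳ c₁ c₂ (i∣m , i∣no) =
  c₂ (i∣m , coprime-divisor (λ (k∣i , k∣n) → c₁ (∣-trans k∣i i∣m , k∣n)) i∣no)

coprime-^ʳ : ∀ {m n} → Coprime m n → ∀ k → Coprime m (n ^ k)
coprime-^ʳ c zero    (_ , i∣1) = ∣1⇒≡1 i∣1
coprime-^ʳ c (suc k) = coprime-*ʳ c (coprime-^ʳ c k)

coprime-^ : ∀ {m n} → Coprime m n → ∀ k l → Coprime (m ^ k) (n ^ l)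
coprime-^ c k l = Coprime.sym (coprime-^ʳ (Coprime.sym (coprime-^ʳ c l)) k)

coprime⇒*∣ : ∀ {m n x} → Coprime m n → m ∣ x → n ∣ x → m * n ∣ x
coprime⇒*∣ {m} {n} c (divides q refl) n∣qm =
  subst (_∣ q * m) (*-comm n m)
    (*-monoˡ-∣ m (coprime-divisor (Coprime.sym c) (subst (n ∣_) (*-comm q m) n∣qm)))

distinct-primes-coprime : ∀ {q r} → Prime q → Prime r → q ≢ r → Coprime q r
distinct-primes-coprime pq pr q≢r (i∣q , i∣r) with prime⇒irreducible pq i∣q
... | inj₁ i≡1 = i≡1
... | inj₂ refl with prime⇒irreducible pr i∣r
...   | inj₁ q≡1  = ⊥-elim (prime∤1 pq (∣-reflexive q≡1))
...   | inj₂ q≡r  = ⊥-elim (q≢r q≡r)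

[m*n]^k≡m^k*n^k : ∀ m n k → (m * n) ^ k ≡ m ^ k * n ^ k
[m*n]^k≡m^k*n^k m n zero    = refl
[m*n]^k≡m^k*n^k m n (suc k) =
  trans (cong (m * n *_) ([m*n]^k≡m^k*n^k m n k)) (interchange m n (m ^ k) (n ^ k))
  where
  interchange : ∀ a b c d → a * b * (c * d) ≡ a * c * (b * d)
  interchange = solve-∀

^-monoʳ-∣ : ∀ m {k l} → k ≤ l → m ^ k ∣ m ^ l
^-monoʳ-∣ m {k} {l} k≤l = subst (λ t → m ^ k ∣ m ^ t) (m+[n∸m]≡n k≤l)
  (subst (m ^ k ∣_) (sym (^-distribˡ-+-* m k (l ∸ k))) (m∣m*n (m ^ (l ∸ k))))

^-monoˡ-∣ : ∀ {m n} k → m ∣ n → m ^ k ∣ n ^ k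
^-monoˡ-∣ zero    m∣n = ∣-refl
^-monoˡ-∣ (suc k) m∣n = *-pres-∣ m∣n (^-monoˡ-∣ k m∣n)

prime-powers-∣ : ∀ {x N} j qs ℓs → Unique qs → All Prime qs → All (λ q → q ^ N ∣ x) qs →
                 sum ℓs * j ≤ N → product (zipWith _^_ qs ℓs) ^ j ∣ x
prime-powers-∣ {x} j [] ℓs _ _ _ _ = subst (_∣ x) (sym (^-zeroˡ j)) (1∣ x)
prime-powers-∣ {x} j (q ∷ qs) [] _ _ _ _ = subst (_∣ x) (sym (^-zeroˡ j)) (1∣ x)
prime-powers-∣ {x} {N} j (q ∷ qs) (ℓ ∷ ℓs) (q∉qs ∷ u) (pq ∷ pqs) (q^N∣x ∷ divs) Σℓj≤N =
  subst (_∣ x) (sym expand)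
    (coprime⇒*∣ (coprime-^ (coprime-with-rest qs ℓs pqs q∉qs) (ℓ * j) j) q-part rest-part)
  where
  P = product (zipWith _^_ qs ℓs)
  expand : (q ^ ℓ * P) ^ j ≡ q ^ (ℓ * j) * P ^ j
  expand = trans ([m*n]^k≡m^k*n^k (q ^ ℓ) P j) (cong (_* P ^ j) (^-*-assoc q ℓ j))
  split : ℓ * j + sum ℓs * j ≤ N
  split = subst (_≤ N) (*-distribʳ-+ j ℓ (sum ℓs)) Σℓj≤N
  q-part : q ^ (ℓ * j) ∣ x
  q-part = ∣-trans (^-monoʳ-∣ q (≤-trans (m≤m+n (ℓ * j) _) split)) q^N∣x
  rest-part : P ^ j ∣ x
  rest-part = prime-powers-∣ j qs ℓs u pqs divs (≤-trans (m≤n+m _ (ℓ * j)) split)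
  coprime-with-rest : ∀ rs ks → All Prime rs → All (q ≢_) rs → Coprime q (product (zipWith _^_ rs ks))
  coprime-with-rest []       ks       _          _           (_ , i∣1) = ∣1⇒≡1 i∣1
  coprime-with-rest (r ∷ rs) []       _          _           (_ , i∣1) = ∣1⇒≡1 i∣1
  coprime-with-rest (r ∷ rs) (k ∷ ks) (pr ∷ prs) (q≢r ∷ q∉rs) =
    coprime-*ʳ (coprime-^ʳ (distinct-primes-coprime pq pr q≢r) k) (coprime-with-rest rs ks prs q∉rs)

^-sum≤product : ∀ {p} qs ℓs → length ℓs ≡ length qs → All (p ≤_) qs →
                p ^ sum ℓs ≤ product (zipWith _^_ qs ℓs)
^-sum≤product []       []       _  _ = ≤-refl
^-sum≤product (q ∷ qs) (ℓ ∷ ℓs) eq (p≤q ∷ p≤qs) =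
  subst (_≤ q ^ ℓ * product (zipWith _^_ qs ℓs)) (sym (^-distribˡ-+-* _ ℓ (sum ℓs)))
    (*-mono-≤ (^-monoˡ-≤ ℓ p≤q) (^-sum≤product qs ℓs (suc-injective eq) p≤qs))

linear≤exponential : ∀ {K L p} → 1 ≤ K → K ≤ L → 2 ≤ p → L * p ^ K ≤ K * p ^ L
linear≤exponential {K} {L} {p} 1≤K K≤L 2≤p =
  subst (λ t → t * p ^ K ≤ K * p ^ t) (m+[n∸m]≡n K≤L) (shift (L ∸ K))
  where
  open ≤-Reasoning
  instance
    p≢0 : NonZero p
    p≢0 = >-nonZero (≤-trans (s≤s z≤n) 2≤p)
  shift : ∀ d → (K + d) * p ^ K ≤ K * p ^ (K + d)
  shift zero    rewrite +-identityʳ K = ≤-refl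
  shift (suc d) = begin
    (K + suc d) * p ^ K       ≡⟨ e₁ K d (p ^ K) ⟩
    p ^ K + (K + d) * p ^ K   ≤⟨ +-mono-≤ p^K≤Y (shift d) ⟩
    K * Y + K * Y             ≡⟨ e₂ (K * Y) ⟩
    2 * (K * Y)               ≤⟨ *-monoˡ-≤ (K * Y) 2≤p ⟩
    p * (K * Y)               ≡⟨ e₃ p K Y ⟩
    K * (p * Y)               ≡⟨ cong (λ t → K * p ^ t) (sym (+-suc K d)) ⟩
    K * p ^ (K + suc d)       ∎
    where
    Y = p ^ (K + d)
    p^K≤Y : p ^ K ≤ K * Y
    p^K≤Y = ≤-trans (^-monoʳ-≤ p (m≤m+n K d)) (m≤n*m Y K {{>-nonZero 1≤K}})
    e₁ : ∀ K d x → (K + suc d) * x ≡ x + (K + d) * x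
    e₁ = solve-∀
    e₂ : ∀ x → x + x ≡ 2 * x
    e₂ = solve-∀
    e₃ : ∀ p K Y → p * (K * Y) ≡ K * (p * Y)
    e₃ = solve-∀

2*k≤2^k : ∀ k → 2 * k ≤ 2 ^ k
2*k≤2^k zero    = z≤n
2*k≤2^k (suc d) =
  subst₂ _≤_ (*-comm (suc d) 2) (*-identityˡ (2 ^ suc d))
    (linear≤exponential {1} {suc d} ≤-refl (s≤s z≤n) ≤-refl)

k*k≤2^k : ∀ k → 4 ≤ k → k * k ≤ 2 ^ k
k*k≤2^k k 4≤k = subst (λ t → t * t ≤ 2 ^ t) (m+[n∸m]≡n 4≤k) (from4 (k ∸ 4))
  where
  from4 : ∀ m → (4 + m) * (4 + m) ≤ 2 ^ (4 + m)
  from4 zero    = ≤-refl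
  from4 (suc m) = ≤-trans step (*-monoʳ-≤ 2 (from4 m))
    where
    eq : ∀ m → (5 + m) * (5 + m) + (m * m + 6 * m + 7) ≡ 2 * ((4 + m) * (4 + m))
    eq = solve-∀
    step : (5 + m) * (5 + m) ≤ 2 * ((4 + m) * (4 + m))
    step = subst ((5 + m) * (5 + m) ≤_) (eq m) (m≤m+n _ _)

-- Once k ≥ j + 4, 2^k outgrows j k; this is what makes the exceptional set finite.
j*k≤2^k : ∀ j k → j + 4 ≤ k → j * k ≤ 2 ^ k
j*k≤2^k j k j+4≤k =
  ≤-trans (*-monoˡ-≤ k (≤-trans (m≤m+n j 4) j+4≤k)) (k*k≤2^k k (≤-trans (m≤n+m 4 j) j+4≤k))

large-exponent⇒∣ : ∀ {j c K G} qs ℓs → Unique qs → All Prime qs → All (_∣ c) qs →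
                   length ℓs ≡ length qs → G ≡ product (zipWith _^_ qs ℓs) →
                   1 ≤ K → KCond j c K → K ≤ sum ℓs → G ^ j ∣ c ^ G
large-exponent⇒∣ {j} {c} {K} {G} qs ℓs distinct primes divide len G≡∏ 1≤K
                 (p , m , (pp , _ , p-smallest) , (_ , q^m∣c) , Kj≤mp^K) K≤L =
  subst (λ t → t ^ j ∣ c ^ G) (sym G≡∏) (prime-powers-∣ j qs ℓs distinct primes q^mG∣c^G Lj≤mG)
  where
  L = sum ℓs
  instance
    p^K≢0 : NonZero (p ^ K)
    p^K≢0 = m^n≢0 p K {{>-nonZero (≤-trans (s≤s z≤n) (prime≥2 pp))}}
  p^L≤G : p ^ L ≤ G
  p^L≤G = subst (p ^ L ≤_) (sym G≡∏)
            (^-sum≤product qs ℓs len (All.zipWith (λ (pq , q∣c) → p-smallest _ pq q∣c) (primes , divide)))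
  Lj≤mG : L * j ≤ m * G
  Lj≤mG = ≤-trans (*-cancelʳ-≤ (L * j) (m * p ^ L) (p ^ K) chain) (*-monoʳ-≤ m p^L≤G)
    where
    open ≤-Reasoning
    e₁ : ∀ L j x → L * j * x ≡ j * (L * x)
    e₁ = solve-∀
    e₂ : ∀ j K y → j * (K * y) ≡ K * j * y
    e₂ = solve-∀
    e₃ : ∀ m x y → m * x * y ≡ m * y * x
    e₃ = solve-∀
    chain : L * j * p ^ K ≤ m * p ^ L * p ^ K
    chain = begin
      L * j * p ^ K      ≡⟨ e₁ L j (p ^ K) ⟩
      j * (L * p ^ K)    ≤⟨ *-monoʳ-≤ j (linear≤exponential 1≤K K≤L (prime≥2 pp)) ⟩
      j * (K * p ^ L)    ≡⟨ e₂ j K (p ^ L) ⟩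
      K * j * p ^ L      ≤⟨ *-monoˡ-≤ (p ^ L) Kj≤mp^K ⟩
      m * p ^ K * p ^ L  ≡⟨ e₃ m (p ^ K) (p ^ L) ⟩
      m * p ^ L * p ^ K  ∎
  q^mG∣c^G : All (λ q → q ^ (m * G) ∣ c ^ G) qs
  q^mG∣c^G = All.zipWith (λ (pq , q∣c) → subst (_∣ c ^ G) (^-*-assoc _ m G) (^-monoˡ-∣ G (q^m∣c _ pq q∣c)))
                         (primes , divide)

+m^k≡+[m^k] : ∀ m k → (+ m) ℤ.^ k ≡ + (m ^ k)
+m^k≡+[m^k] m zero    = refl
+m^k≡+[m^k] m (suc k) = trans (cong (+ m ℤ.*_) (+m^k≡+[m^k] m k)) (sym (ℤP.pos-* m (m ^ k)))

[x*y]^k≡x^k*y^k : ∀ x y k → (x ℤ.* y) ℤ.^ k ≡ x ℤ.^ k ℤ.* y ℤ.^ k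
[x*y]^k≡x^k*y^k x y zero    = refl
[x*y]^k≡x^k*y^k x y (suc k) =
  trans (cong (x ℤ.* y ℤ.*_) ([x*y]^k≡x^k*y^k x y k)) (interchange x y (x ℤ.^ k) (y ℤ.^ k))
  where
  interchange : ∀ a b c d → a ℤ.* b ℤ.* (c ℤ.* d) ≡ a ℤ.* c ℤ.* (b ℤ.* d)
  interchange = ZR.solve-∀

InR⇔ : ∀ j x y n → InR j x y n ⇔ (1 ≤ n × n ^ j ∣ ℤ.∣ x ℤ.^ n ℤ.- y ℤ.^ n ∣)
InR⇔ j x y n = mk⇔ (λ (1≤n , d) → 1≤n , subst (_∣ _) abs[n^j] d)
                   (λ (1≤n , d) → 1≤n , subst (_∣ _) (sym abs[n^j]) d)
  where
  abs[n^j] : ℤ.∣ (+ n) ℤ.^ j ∣ ≡ n ^ j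
  abs[n^j] = cong ℤ.∣_∣ (+m^k≡+[m^k] n j)

InR? : ∀ j x y n → Dec (InR j x y n)
InR? j x y n = (1 ≤? n) ×-dec (ℤ.∣ (+ n) ℤ.^ j ∣ ∣? ℤ.∣ x ℤ.^ n ℤ.- y ℤ.^ n ∣)

∣[xg]^n-[yg]^n∣ : ∀ x y g n → ℤ.∣ (x ℤ.* + g) ℤ.^ n ℤ.- (y ℤ.* + g) ℤ.^ n ∣ ≡ ℤ.∣ x ℤ.^ n ℤ.- y ℤ.^ n ∣ * g ^ n
∣[xg]^n-[yg]^n∣ x y g n = begin
  ℤ.∣ (x ℤ.* + g) ℤ.^ n ℤ.- (y ℤ.* + g) ℤ.^ n ∣  ≡⟨ cong ℤ.∣_∣ (cong₂ ℤ._-_ (pull x) (pull y)) ⟩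
  ℤ.∣ x ℤ.^ n ℤ.* gⁿ ℤ.- y ℤ.^ n ℤ.* gⁿ ∣         ≡⟨ cong ℤ.∣_∣ (factor-out (x ℤ.^ n) (y ℤ.^ n) gⁿ) ⟩
  ℤ.∣ (x ℤ.^ n ℤ.- y ℤ.^ n) ℤ.* gⁿ ∣              ≡⟨ ℤP.abs-* (x ℤ.^ n ℤ.- y ℤ.^ n) gⁿ ⟩
  ℤ.∣ x ℤ.^ n ℤ.- y ℤ.^ n ∣ * g ^ n              ∎
  where
  open ≡-Reasoning
  gⁿ = + (g ^ n)
  pull : ∀ z → (z ℤ.* + g) ℤ.^ n ≡ z ℤ.^ n ℤ.* gⁿ
  pull z = trans ([x*y]^k≡x^k*y^k z (+ g) n) (cong (z ℤ.^ n ℤ.*_) (+m^k≡+[m^k] g n))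
  factor-out : ∀ u v w → u ℤ.* w ℤ.- v ℤ.* w ≡ (u ℤ.- v) ℤ.* w
  factor-out = ZR.solve-∀

positive-factor : ∀ m {n} → 1 ≤ m * n → 1 ≤ m
positive-factor (suc _) _ = s≤s z≤n

module Smooth (g : ℕ) where

  InF-1 : InF g 1
  InF-1 = ≤-refl , λ p pp p∣1 → ⊥-elim (prime∤1 pp p∣1)

  InF-*prime : ∀ {G p} → Prime p → p ∣ g → InF g G → InF g (G * p)
  InF-*prime {G} {p} pp p∣g (1≤G , F) = *-mono-≤ 1≤G (≤-trans (s≤s z≤n) (prime≥2 pp)) , F′
    where
    F′ : ∀ q → Prime q → q ∣ G * p → q ∣ g
    F′ q pq q∣Gp with euclidsLemma G p pq q∣Gp
    ... | inj₁ q∣G = F q pq q∣G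
    ... | inj₂ q∣p with prime⇒irreducible pp q∣p
    ...   | inj₁ refl = ⊥-elim (prime∤1 pq ∣-refl)
    ...   | inj₂ refl = p∣g

  InF-cancel : ∀ {G p} → InF g (G * p) → InF g G
  InF-cancel {G} {p} (1≤Gp , F) = positive-factor G 1≤Gp , λ q pq q∣G → F q pq (∣m⇒∣m*n p q∣G)

  smooth-induction : (P : ℕ → Set) → P 1 → (∀ {G p} → Prime p → p ∣ g → P G → P (G * p)) →
                     ∀ G → InF g G → P G
  smooth-induction P base step G = go G (<-wellFounded G)
    where
    go : ∀ G → Acc _<_ G → InF g G → P G
    go zero            _         (() , _)
    go 1               _         _          = base
    go G@(suc (suc _)) (acc rec) IF@(_ , F) with prime-divisor G (s≤s (s≤s z≤n))
    ... | p , pp , divides G′ G≡G′p = subst P (sym G≡G′p) (step pp p∣g (go G′ (rec G′<G) IF′))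
      where
      IF′ : InF g G′
      IF′ = InF-cancel (subst (InF g) G≡G′p IF)
      p∣g : p ∣ g
      p∣g = F p pp (divides G′ G≡G′p)
      G′<G : G′ < G
      G′<G = subst (G′ <_) (sym G≡G′p) (m<m*n G′ p {{>-nonZero (proj₁ IF′)}} (prime≥2 pp))

  smooth-∣-power : ∀ G → InF g G → ∃[ k ] (G ∣ g ^ k × 2 ^ k ≤ G)
  smooth-∣-power = smooth-induction _ (0 , ∣-refl , ≤-refl) step
    where
    step : ∀ {G p} → Prime p → p ∣ g → ∃[ k ] (G ∣ g ^ k × 2 ^ k ≤ G) →
           ∃[ k ] (G * p ∣ g ^ k × 2 ^ k ≤ G * p)
    step {G} {p} pp p∣g (k , G∣g^k , 2^k≤G) =
      suc k , subst (_∣ g ^ suc k) (*-comm p G) (*-pres-∣ p∣g G∣g^k)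
            , subst (2 ^ suc k ≤_) (*-comm p G) (*-mono-≤ (prime≥2 pp) 2^k≤G)

  smooth-coprime : ∀ {G n} → InF g G → gcd g n ≡ 1 → Coprime G n
  smooth-coprime {G} IF g⊥n with smooth-∣-power G IF
  ... | k , G∣g^k , _ = Coprime.sym (coprime-∣ʳ (coprime-^ʳ (Coprime.sym (gcd≡1⇒coprime g⊥n)) k) G∣g^k)

  Decomposition : ℕ → Set
  Decomposition n = ∃[ G ] ∃[ n₁ ] (n ≡ G * n₁ × InF g G × gcd g n₁ ≡ 1)

  decompose : 0 < g → ∀ n → 1 ≤ n → Decomposition n
  decompose 0<g n = go n (<-wellFounded n)
    where
    >1 : ∀ d → d ≢ 0 → d ≢ 1 → 1 < d
    >1 0             d≢0 _   = ⊥-elim (d≢0 refl)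
    >1 1             _   d≢1 = ⊥-elim (d≢1 refl)
    >1 (suc (suc _)) _   _   = s≤s (s≤s z≤n)
    go : ∀ n → Acc _<_ n → 1 ≤ n → Decomposition n
    go n (acc rec) 1≤n with gcd g n ℕ.≟ 1
    ... | yes g⊥n = 1 , n , sym (*-identityˡ n) , InF-1 , g⊥n
    ... | no  g⊥̸n with prime-divisor (gcd g n) (>1 _ gcd≢0 g⊥̸n)
      where gcd≢0 = λ gcd≡0 → <⇒≢ 0<g (sym (gcd[m,n]≡0⇒m≡0 gcd≡0))
    ...   | p , pp , p∣gcd with ∣-trans p∣gcd (gcd[m,n]∣n g n)
    ...     | divides n′ n≡n′p with go n′ (rec n′<n) 1≤n′
      where
      1≤n′ = positive-factor n′ (subst (1 ≤_) n≡n′p 1≤n)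
      n′<n = subst (n′ <_) (sym n≡n′p) (m<m*n n′ p {{>-nonZero 1≤n′}} (prime≥2 pp))
    ...       | G′ , n₁ , n′≡G′n₁ , IF′ , g⊥n₁ =
      G′ * p , n₁ , n≡G′pn₁ , InF-*prime pp (∣-trans p∣gcd (gcd[m,n]∣m g n)) IF′ , g⊥n₁
      where
      swap : ∀ a b c → a * b * c ≡ a * c * b
      swap = solve-∀
      n≡G′pn₁ : n ≡ G′ * p * n₁
      n≡G′pn₁ = trans n≡n′p (trans (cong (_* p) n′≡G′n₁) (swap G′ n₁ p))

  decomposition-unique : ∀ {G n₁ G′ n₁′} → G * n₁ ≡ G′ * n₁′ → InF g G → InF g G′ →
                         gcd g n₁ ≡ 1 → gcd g n₁′ ≡ 1 → G ≡ G′ × n₁ ≡ n₁′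
  decomposition-unique {G} {n₁} {G′} {n₁′} eq IF IF′ g⊥n₁ g⊥n₁′ = G≡G′ , n₁≡n₁′
    where
    G∣G′ : G ∣ G′
    G∣G′ = coprime-divisor (smooth-coprime IF g⊥n₁′) (subst (G ∣_) (trans eq (*-comm G′ n₁′)) (m∣m*n n₁))
    G′∣G : G′ ∣ G
    G′∣G = coprime-divisor (smooth-coprime IF′ g⊥n₁) (subst (G′ ∣_) (trans (sym eq) (*-comm G n₁)) (m∣m*n n₁′))
    G≡G′ = ∣-antisym G∣G′ G′∣G
    n₁≡n₁′ = *-cancelˡ-≡ n₁ n₁′ G {{>-nonZero (proj₁ IF)}} (trans eq (cong (_* n₁′) (sym G≡G′)))

  Factorisation : List ℕ → ℕ → List ℕ → Set
  Factorisation qs G ℓs = length ℓs ≡ length qs × G ≡ product (zipWith _^_ qs ℓs)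

  factorisation : ∀ qs → (∀ q → Prime q → q ∣ g → q ∈ qs) → ∀ G → InF g G → ∃[ ℓs ] Factorisation qs G ℓs
  factorisation qs covers =
    smooth-induction _ (replicate (length qs) 0 , length-replicate (length qs) , sym (∏q^0 qs)) step
    where
    ∏q^0 : ∀ qs → product (zipWith _^_ qs (replicate (length qs) 0)) ≡ 1
    ∏q^0 []       = refl
    ∏q^0 (q ∷ qs) = cong (1 *_) (∏q^0 qs)
    raise : ∀ {p} qs ℓs → p ∈ qs → length ℓs ≡ length qs →
            ∃[ ℓs′ ] (length ℓs′ ≡ length qs × product (zipWith _^_ qs ℓs′) ≡ p * product (zipWith _^_ qs ℓs))
    raise (q ∷ qs) (ℓ ∷ ℓs) (here refl) eq = suc ℓ ∷ ℓs , eq , *-assoc q (q ^ ℓ) _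
    raise {p} (q ∷ qs) (ℓ ∷ ℓs) (there p∈qs) eq with raise qs ℓs p∈qs (suc-injective eq)
    ... | ℓs′ , eq′ , ∏≡ = ℓ ∷ ℓs′ , cong suc eq′ , trans (cong (q ^ ℓ *_) ∏≡) (*-left-comm (q ^ ℓ) p _)
      where
      *-left-comm : ∀ a b c → a * (b * c) ≡ b * (a * c)
      *-left-comm = solve-∀
    step : ∀ {G p} → Prime p → p ∣ g → ∃[ ℓs ] Factorisation qs G ℓs → ∃[ ℓs ] Factorisation qs (G * p) ℓs
    step {G} {p} pp p∣g (ℓs , len , G≡∏) with raise qs ℓs (covers p pp p∣g) len
    ... | ℓs′ , len′ , ∏≡ = ℓs′ , len′ , trans (*-comm G p) (trans (cong (p *_) G≡∏) (sym ∏≡))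

  power-∣-criterion : ∀ j {G n₁ X} → InF g G → gcd g n₁ ≡ 1 →
                      (G * n₁) ^ j ∣ X * g ^ (G * n₁) ⇔ (n₁ ^ j ∣ X × G ^ j ∣ X * g ^ (G * n₁))
  power-∣-criterion j {G} {n₁} {X} IF g⊥n₁ = mk⇔ split join
    where
    n = G * n₁
    expand = [m*n]^k≡m^k*n^k G n₁ j
    split : n ^ j ∣ X * g ^ n → n₁ ^ j ∣ X × G ^ j ∣ X * g ^ n
    split n^j∣ = coprime-divisor n₁^j⊥g^n (subst (n₁ ^ j ∣_) (*-comm X (g ^ n)) (∣-trans (n∣m*n (G ^ j)) G^jn₁^j∣))
               , ∣-trans (m∣m*n (n₁ ^ j)) G^jn₁^j∣
      where
      G^jn₁^j∣ = subst (_∣ X * g ^ n) expand n^j∣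
      n₁^j⊥g^n = coprime-^ (Coprime.sym (gcd≡1⇒coprime g⊥n₁)) j n
    join : n₁ ^ j ∣ X × G ^ j ∣ X * g ^ n → n ^ j ∣ X * g ^ n
    join (n₁^j∣X , G^j∣) = subst (_∣ X * g ^ n) (sym expand)
      (coprime⇒*∣ (coprime-^ (smooth-coprime IF g⊥n₁) j j) G^j∣ (∣-trans n₁^j∣X (m∣m*n (g ^ n))))

  -- Exceptional decompositions: when G ^ j ∤ g ^ n (n = G * n₁), both G and
  -- n₁ are small in terms of j.
  module Exceptional (j : ℕ) {G n₁} (IF : InF g G) (1≤n₁ : 1 ≤ n₁) (G^j∤ : ¬ (G ^ j ∣ g ^ (G * n₁))) where

    private
      k = proj₁ (smooth-∣-power G IF)
      G∣g^k = proj₁ (proj₂ (smooth-∣-power G IF))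
      2^k≤G = proj₂ (proj₂ (smooth-∣-power G IF))

      -- since G ∣ g ^ k, divisibility holds as soon as n ≥ k j
      k*j≰n : ¬ (k * j ≤ G * n₁)
      k*j≰n kj≤n = G^j∤ (∣-trans (subst (G ^ j ∣_) (^-*-assoc g k j) (^-monoˡ-∣ j G∣g^k)) (^-monoʳ-∣ g kj≤n))

      n<j*k : G * n₁ < j * k
      n<j*k = subst (G * n₁ <_) (*-comm k j) (≰⇒> k*j≰n)

      k<j+4 : k < j + 4
      k<j+4 with j + 4 ≤? k
      ... | no  k≱ = ≰⇒> k≱
      ... | yes j+4≤k = ⊥-elim (<-irrefl refl (<-≤-trans 2^k<j*k (j*k≤2^k j k j+4≤k)))
        where 2^k<j*k = ≤-<-trans (≤-trans 2^k≤G (m≤m*n G n₁ {{>-nonZero 1≤n₁}})) n<j*k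

    bounded : G * n₁ ≤ j * (j + 4)
    bounded = ≤-trans (<⇒≤ n<j*k) (*-monoʳ-≤ j (<⇒≤ k<j+4))

    2*n₁<j : 2 * n₁ < j
    2*n₁<j with j ≤? 2 * n₁
    ... | no  j≰ = ≰⇒> j≰
    ... | yes j≤2n₁ = ⊥-elim (k*j≰n (begin
      k * j          ≤⟨ *-monoʳ-≤ k j≤2n₁ ⟩
      k * (2 * n₁)   ≡⟨ reassoc k n₁ ⟩
      2 * k * n₁     ≤⟨ *-monoˡ-≤ n₁ (≤-trans (2*k≤2^k k) 2^k≤G) ⟩
      G * n₁         ∎))
      where
      open ≤-Reasoning
      reassoc : ∀ k n → k * (2 * n) ≡ 2 * k * n
      reassoc = solve-∀

    exponent<K : ∀ qs ℓs → Unique qs → All Prime qs → All (_∣ g) qs → Factorisation qs G ℓs →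
                 ∀ K → IsK j (g ^ n₁) K → sum ℓs < K
    exponent<K qs ℓs distinct primes divide (len , G≡∏) K (1≤K , K-cond , _) with sum ℓs <? K
    ... | yes L<K = L<K
    ... | no  L≮K = ⊥-elim (G^j∤ (subst (G ^ j ∣_) g^n₁^G≡g^n
          (large-exponent⇒∣ qs ℓs distinct primes (All.map (λ q∣g → ∣-trans q∣g g∣g^n₁) divide)
                             len G≡∏ 1≤K K-cond (≮⇒≥ L≮K))))
      where
      g∣g^n₁ : g ∣ g ^ n₁
      g∣g^n₁ = subst (_∣ g ^ n₁) (^-identityʳ g) (^-monoʳ-∣ g 1≤n₁)
      g^n₁^G≡g^n : (g ^ n₁) ^ G ≡ g ^ (G * n₁)
      g^n₁^G≡g^n = trans (^-*-assoc g n₁ G) (cong (g ^_) (*-comm n₁ G))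

module Setting (j g : ℕ) (0<g : 0 < g) (a₁ b₁ : ℤ) {a b : ℤ}
               (a≡a₁g : a ≡ a₁ ℤ.* + g) (b≡b₁g : b ≡ b₁ ℤ.* + g) where
  open Smooth g
  open Equivalence using (to; from)

  -- D n = |a₁ⁿ - b₁ⁿ|, so that |aⁿ - bⁿ| = D n * gⁿ.
  D : ℕ → ℕ
  D n = ℤ.∣ a₁ ℤ.^ n ℤ.- b₁ ℤ.^ n ∣

  InR-ab⇔ : ∀ n → InR j a b n ⇔ (1 ≤ n × n ^ j ∣ D n * g ^ n)
  InR-ab⇔ n = subst (λ t → InR j a b n ⇔ (1 ≤ n × n ^ j ∣ t)) |aⁿ-bⁿ|≡Dgⁿ (InR⇔ j a b n)
    where
    |aⁿ-bⁿ|≡Dgⁿ : ℤ.∣ a ℤ.^ n ℤ.- b ℤ.^ n ∣ ≡ D n * g ^ n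
    |aⁿ-bⁿ|≡Dgⁿ = trans (cong₂ (λ x y → ℤ.∣ x ℤ.^ n ℤ.- y ℤ.^ n ∣) a≡a₁g b≡b₁g) (∣[xg]^n-[yg]^n∣ a₁ b₁ g n)

  InR-reduced⇔ : ∀ G n₁ → InR j (a₁ ℤ.^ G) (b₁ ℤ.^ G) n₁ ⇔ (1 ≤ n₁ × n₁ ^ j ∣ D (G * n₁))
  InR-reduced⇔ G n₁ = subst (λ t → InR j (a₁ ℤ.^ G) (b₁ ℤ.^ G) n₁ ⇔ (1 ≤ n₁ × n₁ ^ j ∣ t)) |…|≡D
                              (InR⇔ j (a₁ ℤ.^ G) (b₁ ℤ.^ G) n₁)
    where
    |…|≡D : ℤ.∣ (a₁ ℤ.^ G) ℤ.^ n₁ ℤ.- (b₁ ℤ.^ G) ℤ.^ n₁ ∣ ≡ D (G * n₁)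
    |…|≡D = cong₂ (λ x y → ℤ.∣ x ℤ.- y ∣) (ℤP.^-*-assoc a₁ G n₁) (ℤP.^-*-assoc b₁ G n₁)

  Reduced : ℕ → Set
  Reduced n = ∃[ G ] ∃[ n₁ ] (n ≡ G * n₁ × InF g G × InR j (a₁ ℤ.^ G) (b₁ ℤ.^ G) n₁ × gcd g n₁ ≡ 1)

  InR⇒Reduced : ∀ {n} → InR j a b n → Reduced n
  InR⇒Reduced {n} n∈R with decompose 0<g n (proj₁ n∈R)
  ... | G , n₁ , refl , IF , g⊥n₁ =
    G , n₁ , refl , IF , from (InR-reduced⇔ G n₁) (positive-factor n₁ 1≤n₁G , n₁^j∣D) , g⊥n₁
    where
    1≤n = proj₁ n∈R
    1≤n₁G = subst (1 ≤_) (*-comm G n₁) 1≤n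
    n₁^j∣D = proj₁ (to (power-∣-criterion j IF g⊥n₁) (proj₂ (to (InR-ab⇔ (G * n₁)) n∈R)))

  Reduced⇒InR : ∀ {G n₁} → InF g G → gcd g n₁ ≡ 1 → InR j (a₁ ℤ.^ G) (b₁ ℤ.^ G) n₁ →
                G ^ j ∣ g ^ (G * n₁) → InR j a b (G * n₁)
  Reduced⇒InR {G} {n₁} IF g⊥n₁ n₁∈R G^j∣ =
    from (InR-ab⇔ (G * n₁))
      ( *-mono-≤ (proj₁ IF) 1≤n₁
      , from (power-∣-criterion j IF g⊥n₁) (n₁^j∣D , ∣-trans G^j∣ (n∣m*n (D (G * n₁)))))
    where
    1≤n₁ = proj₁ n₁∈R
    n₁^j∣D = proj₂ (to (InR-reduced⇔ G n₁) n₁∈R)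

  Reduced⇒positive : ∀ {n} → Reduced n → 1 ≤ n
  Reduced⇒positive (G , n₁ , n≡Gn₁ , IF , n₁∈R , _) = subst (1 ≤_) (sym n≡Gn₁) (*-mono-≤ (proj₁ IF) (proj₁ n₁∈R))

  Reduced? : ∀ n → Dec (Reduced n)
  Reduced? zero = no λ red → <⇒≢ (Reduced⇒positive red) refl
  Reduced? n@(suc _) with decompose 0<g n (s≤s z≤n)
  ... | G , n₁ , n≡Gn₁ , IF , g⊥n₁ with InR? j (a₁ ℤ.^ G) (b₁ ℤ.^ G) n₁
  ...   | yes n₁∈R = yes (G , n₁ , n≡Gn₁ , IF , n₁∈R , g⊥n₁)
  ...   | no  n₁∉R = no λ (G′ , n₁′ , n≡G′n₁′ , IF′ , n₁′∈R , g⊥n₁′) →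
    case decomposition-unique (trans (sym n≡Gn₁) n≡G′n₁′) IF IF′ g⊥n₁ g⊥n₁′ of λ where
      (refl , refl) → n₁∉R n₁′∈R

  Exceptional : ℕ → Set
  Exceptional n = Reduced n × ¬ InR j a b n

  Exceptional? : ∀ n → Dec (Exceptional n)
  Exceptional? n = Reduced? n ×-dec ¬? (InR? j a b n)

  exceptional-decomposition : ∀ {n G n₁} → Exceptional n → n ≡ G * n₁ → InF g G → gcd g n₁ ≡ 1 →
                              1 ≤ n₁ × ¬ (G ^ j ∣ g ^ (G * n₁))
  exceptional-decomposition {n} (( G′ , n₁′ , n≡G′n₁′ , IF′ , n₁′∈R , g⊥n₁′) , n∉R) n≡Gn₁ IF g⊥n₁
    with decomposition-unique (trans (sym n≡Gn₁) n≡G′n₁′) IF IF′ g⊥n₁ g⊥n₁′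
  ... | refl , refl = proj₁ n₁′∈R , λ G^j∣ → n∉R (subst (InR j a b) (sym n≡Gn₁) (Reduced⇒InR IF g⊥n₁ n₁′∈R G^j∣))

  bound : ℕ
  bound = j * (j + 4)

  exceptional-bounded : ∀ {n} → Exceptional n → n ≤ bound
  exceptional-bounded e@((G , n₁ , n≡Gn₁ , IF , _ , g⊥n₁) , _)
    with exceptional-decomposition e n≡Gn₁ IF g⊥n₁
  ... | 1≤n₁ , G^j∤ = subst (_≤ bound) (sym n≡Gn₁) (Exceptional.bounded j IF 1≤n₁ G^j∤)

  R : List ℕ
  R = filter Exceptional? (upTo (suc bound))

  ∈R⇒Exceptional : ∀ {n} → n ∈ R → Exceptional n
  ∈R⇒Exceptional n∈R = proj₂ (∈-filter⁻ Exceptional? {xs = upTo (suc bound)} n∈R)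

  Exceptional⇒∈R : ∀ {n} → Exceptional n → n ∈ R
  Exceptional⇒∈R e = ∈-filter⁺ Exceptional? (∈-upTo⁺ (s≤s (exceptional-bounded e))) e

  R-positive : All (λ r → 1 ≤ r) R
  R-positive = All.tabulate (λ n∈R → Reduced⇒positive (proj₁ (∈R⇒Exceptional n∈R)))

  R-characterises : ∀ n → InR j a b n ⇔ (Reduced n × n ∉ R)
  R-characterises n = mk⇔ (λ n∈ → InR⇒Reduced n∈ , λ n∈R → proj₂ (∈R⇒Exceptional n∈R) n∈) backward
    where
    backward : Reduced n × n ∉ R → InR j a b n
    backward (red , n∉R) with InR? j a b n
    ... | yes n∈ = n∈
    ... | no  n∉ = ⊥-elim (n∉R (Exceptional⇒∈R (red , n∉)))

  R-shape : ∀ n → n ∈ R → ∀ G n₁ → n ≡ G * n₁ → InF g G → gcd n₁ g ≡ 1 →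
            (1 ≤ n₁) × (2 * n₁ < j)
            × (∀ (qs : List ℕ) → Unique qs → All Prime qs → All (λ q → q ∣ g) qs →
                 (∀ q → Prime q → q ∣ g → q ∈ qs) →
                 ∃[ ℓs ] (length ℓs ≡ length qs × G ≡ product (zipWith _^_ qs ℓs)
                          × (∀ K → IsK j (g ^ n₁) K → sum ℓs < K)))
  R-shape n n∈R G n₁ n≡Gn₁ IF n₁⊥g
    with exceptional-decomposition (∈R⇒Exceptional n∈R) n≡Gn₁ IF (trans (gcd-comm g n₁) n₁⊥g)
  ... | 1≤n₁ , G^j∤ = 1≤n₁ , 2*n₁<j , shape
    where
    open Exceptional j IF 1≤n₁ G^j∤
    shape : ∀ qs → Unique qs → All Prime qs → All (_∣ g) qs → (∀ q → Prime q → q ∣ g → q ∈ qs) →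
            ∃[ ℓs ] (length ℓs ≡ length qs × G ≡ product (zipWith _^_ qs ℓs)
                     × (∀ K → IsK j (g ^ n₁) K → sum ℓs < K))
    shape qs distinct primes divide covers with factorisation qs covers G IF
    ... | ℓs , len , G≡∏ = ℓs , len , G≡∏ , exponent<K qs ℓs distinct primes divide (len , G≡∏)

theorem4 : (j : ℕ) → 1 ≤ j → (a b : ℤ) → (g : ℕ) → ℤG.gcd a b ≡ + g → 1 < g →
    (a₁ b₁ : ℤ) → a ≡ a₁ ℤ.* + g → b ≡ b₁ ℤ.* + g →
    ∃[ R ] (All (λ r → 1 ≤ r) R
      × (∀ n → InR j a b n ⇔
           ((∃[ G ] ∃[ n₁ ] (n ≡ G * n₁ × InF g G × InR j (a₁ ℤ.^ G) (b₁ ℤ.^ G) n₁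
                             × ℕG.gcd g n₁ ≡ 1))
            × n ∉ R))
      × (∀ n → n ∈ R → ∀ G n₁ → n ≡ G * n₁ → InF g G → ℕG.gcd n₁ g ≡ 1 →
           (1 ≤ n₁) × (2 * n₁ < j)
           × (∀ (qs : List ℕ) → Unique qs → All Prime qs → All (λ q → q ℕD.∣ g) qs →
                (∀ q → Prime q → q ℕD.∣ g → q ∈ qs) →
                ∃[ ℓs ] (length ℓs ≡ length qs × G ≡ product (zipWith _^_ qs ℓs)
                         × (∀ K → IsK j (g ^ n₁) K → sum ℓs < K)))))
theorem4 j _ a b g _ 1<g a₁ b₁ a≡a₁g b≡b₁g = R , R-positive , R-characterises , R-shape
  where open Setting j g (<-trans z<s 1<g) a₁ b₁ a≡a₁g b≡b₁g
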